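{- Let $n\ge 2$ and let $P_n=v_1v_2\cdots v_n$ be a path. Then $$f\big(M(P_n)-\{v_1,v_n\}\big)=2^{n-2}+n-2.$$
   Context: A pebbling move removes two pebbles from a vertex and places one pebble on an adjacent vertex. For a connected graph $G$ and vertex $v$, $f(G,v)$ is the least $N$ such that from every distribution of $N$ pebbles on $G$ one pebble can be moved to $v$; $f(G)=\max_v f(G,v)$. The middle graph $M(P_n)$ is obtained from $P_n$ by inserting a new vertex $u_i$ into each edge $v_iv_{i+1}$ ($1\le i\le n-1$), so that the edge is replaced by the edges $v_iu_i$ and $u_iv_{i+1}$, and adding the edges $u_iu_{i+1}$ for $1\le i\le n-2$. $M(P_n)-\{v_1,v_n\}$ is the graph obtained by deleting the vertices $v_1,v_n$. -}

module Defs where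

open import Data.Nat using (ℕ; zero; suc; _+_; _≤_)
open import Data.Fin using (Fin; toℕ)
open import Data.List using (map; allFin)
open import Data.Nat.ListAction using (sum)
open import Data.Product using (Σ; _×_; ∃)
open import Relation.Binary.PropositionalEquality using (_≡_; _≢_)
open import Relation.Binary.Construct.Closure.ReflexiveTransitive using (Star)

record Graph : Set₁ where
  field
    V     : Set
    Adj   : V → V → Set
    -- total number of pebbles of a distribution (sum over all vertices)
    total : (V → ℕ) → ℕ

module Pebbling (G : Graph) where
  open Graph G

  Distribution : Set
  Distribution = V → ℕ

  Move : Distribution → Distribution → Set
  Move D D' = Σ V λ a → Σ V λ b →
    Adj a b × 2 ≤ D a × D' a + 2 ≡ D a × D' b ≡ suc (D b) ×
    (∀ w → w ≢ a → w ≢ b → D' w ≡ D w)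

  Reach : Distribution → Distribution → Set
  Reach = Star Move

  Solvable : V → Distribution → Set
  Solvable r D = ∃ λ D' → Reach D D' × 1 ≤ D' r

  AllSolvable : V → ℕ → Set
  AllSolvable r N = ∀ (D : Distribution) → total D ≡ N → Solvable r D

  IsRootedPebblingNumber : V → ℕ → Set
  IsRootedPebblingNumber r N = AllSolvable r N × (∀ M → AllSolvable r M → N ≤ M)

  IsPebblingNumber : ℕ → Set
  IsPebblingNumber N =
    (∀ r → Σ ℕ λ Nr → IsRootedPebblingNumber r Nr × Nr ≤ N) ×
    (∃ λ r → IsRootedPebblingNumber r N)

-- M(P_n) - {v_1, v_n}, for n = k + 2.
-- Remaining vertices: v_2, ..., v_{n-1}  (written  v i  for v_{i+2}, i : Fin k)
--                     u_1, ..., u_{n-1}  (written  u j  for u_{j+1}, j : Fin (suc k))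

data MVert (k : ℕ) : Set where
  v : Fin k → MVert k
  u : Fin (suc k) → MVert k

-- Edges of M(P_n) among the remaining vertices (induced subgraph):
--   v_i u_i  and  u_i v_{i+1}   (subdivided path edges),
--   u_i u_{i+1}                 (added edges).
-- In 0-based indices: v i = v_{i+2} is adjacent to u i = u_{i+1} and u (i+1) = u_{i+2}.
data MAdj (k : ℕ) : MVert k → MVert k → Set where
  vu-left  : ∀ i j → toℕ j ≡ toℕ i → MAdj k (v i) (u j)
  vu-right : ∀ i j → toℕ j ≡ suc (toℕ i) → MAdj k (v i) (u j)
  uv-left  : ∀ i j → toℕ j ≡ toℕ i → MAdj k (u j) (v i)
  uv-right : ∀ i j → toℕ j ≡ suc (toℕ i) → MAdj k (u j) (v i)
  uu-up    : ∀ i j → toℕ j ≡ suc (toℕ i) → MAdj k (u i) (u j)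
  uu-down  : ∀ i j → toℕ i ≡ suc (toℕ j) → MAdj k (u i) (u j)

mTotal : (k : ℕ) → (MVert k → ℕ) → ℕ
mTotal k D = sum (map (λ i → D (v i)) (allFin k)) + sum (map (λ j → D (u j)) (allFin (suc k)))

MidPathMinusEnds : ℕ → Graph
MidPathMinusEnds k = record { V = MVert k ; Adj = MAdj k ; total = mTotal k }

-- The graph is the path u_0 — u_1 — ⋯ — u_k with each v_i adjacent to u_i and u_{i+1}.
--
-- On a chain of length ℓ towards a vertex w (the path vertices together with
-- the v's feeding them), c·2^ℓ + ℓ pebbles bring c pebbles to w: each v_i can strand at most
-- one pebble. A root u_p splits the graph into two chains of lengths p and q = k - p ending
-- at u_p; if neither can bring one pebble, there are at most 2^p + 2^q + p + q - 2 < 2^k + k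
-- pebbles, as 2^p + 2^q ≤ 2^(p+q) + 1. An empty root v_i needs two pebbles on u_i or on
-- u_{i+1}, and the same count with c = 2 and p + q = k - 1 applies.
--
-- With 2^k - 1 pebbles on u_k and single pebbles on some v_i, the potential
-- Σ d(u_j)·2^(k-j) + Σ ⌊d(v_i)/2⌋·2^(k-i) is 2^k - 1; no move increases it, while a pebble
-- on u_0 is worth 2^k. So u_0 is unreachable from these distributions of up to 2^k + k - 1
-- pebbles.
--
-- Rooted pebbling numbers exist since solvability is decided by exhaustive search.

module Submission where

open import Defs
open import Data.Nat using (ℕ; _+_; _∸_; _^_; _≤_)

open import Data.Nat.Base using (zero; suc; _*_; _<_; z≤n; s≤s; z<s; ⌊_/2⌋; >-nonZero)
open import Data.Nat.Properties hiding (_≟_)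
open import Data.Nat.Tactic.RingSolver using (solve-∀)
open import Algebra.Properties.CommutativeSemigroup +-commutativeSemigroup using (xy∙z≈xz∙y)
open import Data.Fin.Base as Fin using (Fin; toℕ)
import Data.Fin.Properties as Fin
open import Data.List.Properties using (map-tabulate; tabulate-cong; map-cong)
open import Data.List.Base
  using (List; []; _∷_; _++_; map; allFin; tabulate; upTo; cartesianProduct; cartesianProductWith)
open import Data.List.Membership.Propositional using (_∈_; lose)
open import Data.List.Membership.Propositional.Properties
  using (∈-cartesianProduct⁺; ∈-cartesianProductWith⁺; ∈-upTo⁺; ∈-++⁺ˡ; ∈-++⁺ʳ; ∈-tabulate⁺)
open import Data.List.Relation.Unary.Any as Any using (here; there; any?)
import Data.List.Relation.Unary.All as All
open import Data.Sum.Base using (_⊎_; inj₁; inj₂; [_,_]′)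
open import Data.Nat.ListAction using (sum)
open import Data.Product.Base using (Σ; ∃; _×_; _,_; proj₁; proj₂)
open import Data.Empty using (⊥-elim)
open import Function.Base using (_∘_)
open import Relation.Nullary using (Dec; yes; no; ¬_)
import Relation.Nullary.Decidable as Dec
open import Relation.Nullary.Decidable using (_→-dec_)
import Relation.Unary as U
import Data.Nat.Properties as ℕ
open import Relation.Binary.Definitions using (DecidableEquality; Decidable)
open import Relation.Binary.PropositionalEquality
open import Relation.Binary.Construct.Closure.ReflexiveTransitive using (ε; _◅_; _◅◅_)

surplus-cancel : ∀ {a b x y} → b ≤ a → a + x ≤ b + y → x ≤ y
surplus-cancel {a} {b} {x} {y} b≤a h = +-cancelˡ-≤ b x y (≤-trans (+-monoˡ-≤ x b≤a) h)

scaled-cancel : ∀ {c s P k M} → 1 ≤ P → (c + s) * P + k ≤ M + c → s * P + k ≤ M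
scaled-cancel {c} {s} {P} {k} {M} 1≤P h = surplus-cancel (m≤m*n c P {{>-nonZero 1≤P}}) (begin
  c * P + (s * P + k)  ≡⟨ sym (+-assoc (c * P) (s * P) k) ⟩
  c * P + s * P + k    ≡⟨ cong (_+ k) (sym (*-distribʳ-+ P c s)) ⟩
  (c + s) * P + k      ≤⟨ h ⟩
  M + c                ≡⟨ +-comm M c ⟩
  c + M                ∎)
  where open ≤-Reasoning

peel-one : ∀ {t P k M M'} → 2 ≤ P → suc t * P + k ≤ M → M' + 2 ≡ M → t * P + k ≤ M'
peel-one {t} {P} {k} {M} {M'} 2≤P h M'+2≡M = surplus-cancel 2≤P (begin
  P + (t * P + k)  ≡⟨ sym (+-assoc P (t * P) k) ⟩
  suc t * P + k    ≤⟨ h ⟩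
  M                ≡⟨ sym M'+2≡M ⟩
  M' + 2           ≡⟨ +-comm M' 2 ⟩
  2 + M'           ∎)
  where open ≤-Reasoning

top-up : ∀ {t c s b j M} → c + s ≡ 2 * t → b ≤ 1 →
         t * 2 ^ suc j + suc j ≤ M + (c + b) → s * 2 ^ j + j ≤ M
top-up {t} {c} {s} {b} {j} {M} c+s≡2t b≤1 h = ≤-pred (subst (_≤ suc M) (+-suc (s * 2 ^ j) j)
  (scaled-cancel (m^n>0 2 j) (begin
    (c + s) * 2 ^ j + suc j   ≡⟨ cong (λ z → z * 2 ^ j + suc j) c+s≡2t ⟩
    2 * t * 2 ^ j + suc j     ≡⟨ cong (_+ suc j) (trans (cong (_* 2 ^ j) (*-comm 2 t)) (*-assoc t 2 (2 ^ j))) ⟩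
    t * 2 ^ suc j + suc j     ≤⟨ h ⟩
    M + (c + b)               ≤⟨ +-monoʳ-≤ M (+-monoʳ-≤ c b≤1) ⟩
    M + (c + 1)               ≡⟨ rearrange M c ⟩
    suc M + c                 ∎)))
  where
  open ≤-Reasoning
  rearrange : ∀ M c → M + (c + 1) ≡ suc M + c
  rearrange = solve-∀

+≤*+1 : ∀ {x y} → 1 ≤ x → 1 ≤ y → x + y ≤ x * y + 1
+≤*+1 {suc x} {suc y} _ _ = ≤-trans (m≤m+n (suc x + suc y) (x * y)) (≤-reflexive (identity x y))
  where
  identity : ∀ x y → suc x + suc y + x * y ≡ suc x * suc y + 1
  identity = solve-∀

2^+2^≤2^[+]+1 : ∀ a b → 2 ^ a + 2 ^ b ≤ 2 ^ (a + b) + 1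
2^+2^≤2^[+]+1 a b = begin
  2 ^ a + 2 ^ b       ≤⟨ +≤*+1 (m^n>0 2 a) (m^n>0 2 b) ⟩
  2 ^ a * 2 ^ b + 1   ≡⟨ cong (_+ 1) (sym (^-distribˡ-+-* 2 a b)) ⟩
  2 ^ (a + b) + 1     ∎
  where open ≤-Reasoning

short-halves : ∀ c a b {L R} → suc L ≤ c * 2 ^ a + a → suc R ≤ c * 2 ^ b + b →
               L + R + 2 ≤ c * 2 ^ (a + b) + c + (a + b)
short-halves c a b {L} {R} hL hR = begin
  L + R + 2                          ≡⟨ rearrange L R ⟩
  suc L + suc R                      ≤⟨ +-mono-≤ hL hR ⟩
  c * 2 ^ a + a + (c * 2 ^ b + b)    ≡⟨ collect c (2 ^ a) (2 ^ b) a b ⟩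
  c * (2 ^ a + 2 ^ b) + (a + b)      ≤⟨ +-monoˡ-≤ (a + b) (*-monoʳ-≤ c (2^+2^≤2^[+]+1 a b)) ⟩
  c * (2 ^ (a + b) + 1) + (a + b)    ≡⟨ cong (_+ (a + b)) (*-distribˡ-+ c (2 ^ (a + b)) 1) ⟩
  c * 2 ^ (a + b) + c * 1 + (a + b)  ≡⟨ cong (λ z → c * 2 ^ (a + b) + z + (a + b)) (*-identityʳ c) ⟩
  c * 2 ^ (a + b) + c + (a + b)      ∎
  where
  open ≤-Reasoning
  rearrange : ∀ L R → L + R + 2 ≡ suc L + suc R
  rearrange = solve-∀
  collect : ∀ c x y a b → c * x + a + (c * y + b) ≡ c * (x + y) + (a + b)
  collect = solve-∀

short-halves-u-root : ∀ a b {T E L R} → T + E ≡ L + R →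
                 suc L ≤ 1 * 2 ^ a + a → suc R ≤ 1 * 2 ^ b + b → T < 2 ^ (a + b) + (a + b)
short-halves-u-root a b {T} {E} {L} {R} T+E≡L+R hL hR = ≤-pred (begin
  suc (suc T)                      ≡⟨ +-comm 2 T ⟩
  T + 2                            ≤⟨ +-monoˡ-≤ 2 (m≤m+n T E) ⟩
  T + E + 2                        ≡⟨ cong (_+ 2) T+E≡L+R ⟩
  L + R + 2                        ≤⟨ short-halves 1 a b hL hR ⟩
  1 * 2 ^ (a + b) + 1 + (a + b)    ≡⟨ tidy (2 ^ (a + b)) (a + b) ⟩
  suc (2 ^ (a + b) + (a + b))      ∎)
  where
  open ≤-Reasoning
  tidy : ∀ x s → 1 * x + 1 + s ≡ suc (x + s)
  tidy = solve-∀

short-halves-v-root : ∀ a b {T L R} → T ≡ L + R →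
                      suc L ≤ 2 * 2 ^ a + a → suc R ≤ 2 * 2 ^ b + b → T < 2 ^ suc (a + b) + suc (a + b)
short-halves-v-root a b {T} {L} {R} T≡L+R hL hR = ≤-pred (begin
  suc (suc T)                      ≡⟨ +-comm 2 T ⟩
  T + 2                            ≡⟨ cong (_+ 2) T≡L+R ⟩
  L + R + 2                        ≤⟨ short-halves 2 a b hL hR ⟩
  2 * 2 ^ (a + b) + 2 + (a + b)    ≡⟨ tidy (2 ^ (a + b)) (a + b) ⟩
  suc (2 * 2 ^ (a + b) + suc (a + b))  ∎)
  where
  open ≤-Reasoning
  tidy : ∀ x s → 2 * x + 2 + s ≡ suc (2 * x + suc s)
  tidy = solve-∀

sumBelow : ℕ → (ℕ → ℕ) → ℕ
sumBelow zero    f = 0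
sumBelow (suc n) f = sumBelow n f + f n

sumBelow-cong : ∀ n {f g} → (∀ {i} → i < n → f i ≡ g i) → sumBelow n f ≡ sumBelow n g
sumBelow-cong zero    eq = refl
sumBelow-cong (suc n) eq = cong₂ _+_ (sumBelow-cong n (eq ∘ m<n⇒m<1+n)) (eq ≤-refl)

sumBelow-zero : ∀ n {f} → (∀ {i} → i < n → f i ≡ 0) → sumBelow n f ≡ 0
sumBelow-zero zero    eq = refl
sumBelow-zero (suc n) eq = cong₂ _+_ (sumBelow-zero n (eq ∘ m<n⇒m<1+n)) (eq ≤-refl)

sumBelow-+ : ∀ n f g → sumBelow n (λ i → f i + g i) ≡ sumBelow n f + sumBelow n g
sumBelow-+ zero    f g = refl
sumBelow-+ (suc n) f g = begin
  sumBelow n (λ i → f i + g i) + (f n + g n)        ≡⟨ cong (_+ (f n + g n)) (sumBelow-+ n f g) ⟩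
  sumBelow n f + sumBelow n g + (f n + g n)         ≡⟨ interchange (sumBelow n f) (sumBelow n g) (f n) (g n) ⟩
  sumBelow n f + f n + (sumBelow n g + g n)         ∎
  where
  open ≡-Reasoning
  interchange : ∀ a b c d → a + b + (c + d) ≡ a + c + (b + d)
  interchange = solve-∀

sumBelow-head : ∀ n f → sumBelow (suc n) f ≡ f 0 + sumBelow n (f ∘ suc)
sumBelow-head zero    f = +-comm 0 (f 0)
sumBelow-head (suc n) f = trans (cong (_+ f (suc n)) (sumBelow-head n f)) (+-assoc (f 0) _ _)

sumBelow-split : ∀ a b f → sumBelow (a + b) f ≡ sumBelow a f + sumBelow b (λ i → f (a + i))
sumBelow-split a zero    f = trans (cong (λ n → sumBelow n f) (+-identityʳ a)) (sym (+-identityʳ _))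
sumBelow-split a (suc b) f = begin
  sumBelow (a + suc b) f                                   ≡⟨ cong (λ n → sumBelow n f) (+-suc a b) ⟩
  sumBelow (a + b) f + f (a + b)                           ≡⟨ cong (_+ f (a + b)) (sumBelow-split a b f) ⟩
  sumBelow a f + sumBelow b (λ i → f (a + i)) + f (a + b)  ≡⟨ +-assoc (sumBelow a f) _ _ ⟩
  sumBelow a f + sumBelow (suc b) (λ i → f (a + i))        ∎
  where open ≡-Reasoning

sumBelow-reverse : ∀ n f → sumBelow n (λ i → f (n ∸ suc i)) ≡ sumBelow n f
sumBelow-reverse zero    f = refl
sumBelow-reverse (suc n) f = begin
  sumBelow (suc n) (λ i → f (n ∸ i))          ≡⟨ sumBelow-head n (λ i → f (n ∸ i)) ⟩
  f n + sumBelow n (λ i → f (n ∸ suc i))      ≡⟨ cong (f n +_) (sumBelow-reverse n f) ⟩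
  f n + sumBelow n f                          ≡⟨ +-comm (f n) _ ⟩
  sumBelow n f + f n                          ∎
  where open ≡-Reasoning

sum-tabulate : ∀ n (f : Fin n → ℕ) (g : ℕ → ℕ) → (∀ i → f i ≡ g (toℕ i)) →
               sum (tabulate f) ≡ sumBelow n g
sum-tabulate zero    f g eq = refl
sum-tabulate (suc n) f g eq = begin
  f Fin.zero + sum (tabulate (f ∘ Fin.suc))
    ≡⟨ cong₂ _+_ (eq Fin.zero) (sum-tabulate n (f ∘ Fin.suc) (g ∘ suc) (eq ∘ Fin.suc)) ⟩
  g 0 + sumBelow n (g ∘ suc)                 ≡⟨ sym (sumBelow-head n g) ⟩
  sumBelow (suc n) g                         ∎
  where open ≡-Reasoning

one-if-below : ℕ → ℕ → ℕ
one-if-below zero    _       = 0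
one-if-below (suc m) zero    = 1
one-if-below (suc m) (suc i) = one-if-below m i

⌊one-if-below/2⌋≡0 : ∀ m i → ⌊ one-if-below m i /2⌋ ≡ 0
⌊one-if-below/2⌋≡0 zero    _       = refl
⌊one-if-below/2⌋≡0 (suc m) zero    = refl
⌊one-if-below/2⌋≡0 (suc m) (suc i) = ⌊one-if-below/2⌋≡0 m i

sumBelow-one-if-below : ∀ {m n} → m ≤ n → sumBelow n (one-if-below m) ≡ m
sumBelow-one-if-below {zero}  {n}     _         = sumBelow-zero n (λ _ → refl)
sumBelow-one-if-below {suc m} {suc n} (s≤s m≤n) =
  trans (sumBelow-head n (one-if-below (suc m))) (cong suc (sumBelow-one-if-below m≤n))

sum-allFin : ∀ n (f : Fin n → ℕ) → sum (map f (allFin n)) ≡ sum (tabulate f)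
sum-allFin n f = cong sum (map-tabulate (λ i → i) f)

sum-tabulate-update : ∀ n (f g : Fin n → ℕ) a → (∀ i → i ≢ a → f i ≡ g i) →
                      sum (tabulate f) + g a ≡ sum (tabulate g) + f a
sum-tabulate-update (suc n) f g Fin.zero f≡g = begin
  f Fin.zero + sum (tabulate (f ∘ Fin.suc)) + g Fin.zero  ≡⟨ cong (λ z → f Fin.zero + z + g Fin.zero) tail ⟩
  f Fin.zero + sum (tabulate (g ∘ Fin.suc)) + g Fin.zero  ≡⟨ swap (f Fin.zero) _ (g Fin.zero) ⟩
  g Fin.zero + sum (tabulate (g ∘ Fin.suc)) + f Fin.zero  ∎
  where
  open ≡-Reasoning
  tail : sum (tabulate (f ∘ Fin.suc)) ≡ sum (tabulate (g ∘ Fin.suc))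
  tail = cong sum (tabulate-cong (λ i → f≡g (Fin.suc i) λ ()))
  swap : ∀ x s y → x + s + y ≡ y + s + x
  swap = solve-∀
sum-tabulate-update (suc n) f g (Fin.suc a) f≡g = begin
  f Fin.zero + sum (tabulate (f ∘ Fin.suc)) + g (Fin.suc a)    ≡⟨ +-assoc (f Fin.zero) _ _ ⟩
  f Fin.zero + (sum (tabulate (f ∘ Fin.suc)) + g (Fin.suc a))  ≡⟨ cong₂ _+_ (f≡g Fin.zero λ ()) tail ⟩
  g Fin.zero + (sum (tabulate (g ∘ Fin.suc)) + f (Fin.suc a))  ≡⟨ sym (+-assoc (g Fin.zero) _ _) ⟩
  g Fin.zero + sum (tabulate (g ∘ Fin.suc)) + f (Fin.suc a)    ∎
  where
  open ≡-Reasoning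
  tail : sum (tabulate (f ∘ Fin.suc)) + g (Fin.suc a) ≡ sum (tabulate (g ∘ Fin.suc)) + f (Fin.suc a)
  tail = sum-tabulate-update n (f ∘ Fin.suc) (g ∘ Fin.suc) a
           (λ i i≢a → f≡g (Fin.suc i) (i≢a ∘ Fin.suc-injective))

module Override {V : Set} (_≟_ : DecidableEquality V) where

  _[_≔_] : (V → ℕ) → V → ℕ → (V → ℕ)
  (f [ a ≔ n ]) w with w ≟ a
  ... | yes _ = n
  ... | no _  = f w

  ≔-at : ∀ f a n → (f [ a ≔ n ]) a ≡ n
  ≔-at f a n with a ≟ a
  ... | yes _   = refl
  ... | no a≢a = ⊥-elim (a≢a refl)

  ≔-off : ∀ f {a w} n → w ≢ a → (f [ a ≔ n ]) w ≡ f w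
  ≔-off f {a} {w} n w≢a with w ≟ a
  ... | yes w≡a = ⊥-elim (w≢a w≡a)
  ... | no _    = refl

module Moves (G : Graph) (_≟_ : DecidableEquality (Graph.V G)) where
  open Graph G
  open Pebbling G
  open Override _≟_

  moved : Distribution → V → V → Distribution
  moved D a b = D [ a ≔ D a ∸ 2 ] [ b ≔ suc (D b) ]

  moved-source : ∀ D {a b} → a ≢ b → moved D a b a ≡ D a ∸ 2
  moved-source D {a} a≢b = trans (≔-off _ _ a≢b) (≔-at D a _)

  moved-target : ∀ D a b → moved D a b b ≡ suc (D b)
  moved-target D a b = ≔-at _ b _

  UnchangedOff : V → V → Distribution → Distribution → Set
  UnchangedOff a b D D' = ∀ w → w ≢ a → w ≢ b → D' w ≡ D w

  moved-other : ∀ D a b → UnchangedOff a b D (moved D a b)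
  moved-other D a b w w≢a w≢b = trans (≔-off _ _ w≢b) (≔-off D _ w≢a)

  move : ∀ {D a b} → Adj a b → a ≢ b → 2 ≤ D a → Move D (moved D a b)
  move {D} {a} {b} ab a≢b 2≤Da =
    a , b , ab , 2≤Da , trans (cong (_+ 2) (moved-source D a≢b)) (m∸n+n≡m 2≤Da) ,
    moved-target D a b , moved-other D a b

  move-endpoints-distinct : ∀ {D D'} → ((a , b , _) : Move D D') → a ≢ b
  move-endpoints-distinct {D} {D'} (a , .a , _ , _ , source , target , _) refl =
    1+n≰n (begin
      suc (D a)   ≡⟨ sym target ⟩
      D' a        ≤⟨ m≤m+n (D' a) 2 ⟩
      D' a + 2    ≡⟨ source ⟩
      D a         ∎)
    where open ≤-Reasoning

  move-determined : ∀ {D D'} → (mv@(a , b , _) : Move D D') → D' ≗ moved D a b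
  move-determined {D} {D'} mv@(a , b , _ , _ , source , target , other) w = by-cases (w ≟ a) (w ≟ b)
    where
    open ≡-Reasoning
    by-cases : Dec (w ≡ a) → Dec (w ≡ b) → D' w ≡ moved D a b w
    by-cases (yes refl) _ = begin
      D' w             ≡⟨ sym (m+n∸n≡m (D' w) 2) ⟩
      D' w + 2 ∸ 2     ≡⟨ cong (_∸ 2) source ⟩
      D w ∸ 2          ≡⟨ sym (moved-source D (move-endpoints-distinct mv)) ⟩
      moved D w b w    ∎
    by-cases (no _)    (yes refl) = trans target (sym (moved-target D a w))
    by-cases (no w≢a)  (no w≢b)   = trans (other w w≢a w≢b) (sym (moved-other D a b w w≢a w≢b))

  move-resp-≗ : ∀ {D E D'} → D ≗ E → Move D D' → Move E D'
  move-resp-≗ D≗E (a , b , ab , 2≤Da , source , target , other) =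
    a , b , ab , subst (2 ≤_) (D≗E a) 2≤Da , trans source (D≗E a) ,
    trans target (cong suc (D≗E b)) , λ w w≢a w≢b → trans (other w w≢a w≢b) (D≗E w)

  solvable-resp-≗ : ∀ {r D E} → D ≗ E → Solvable r D → Solvable r E
  solvable-resp-≗ {r} D≗E (D' , ε , 1≤D'r)       = _ , ε , subst (1 ≤_) (D≗E r) 1≤D'r
  solvable-resp-≗ D≗E (D' , mv ◅ moves , 1≤D'r) = D' , move-resp-≗ D≗E mv ◅ moves , 1≤D'r

  solvable-from-neighbour : ∀ {r a D D₁} → Adj a r → a ≢ r → Reach D D₁ → 2 ≤ D₁ a → Solvable r D
  solvable-from-neighbour {r} {a} {D₁ = D₁} ar a≢r moves 2≤D₁a =
    moved D₁ a r , moves ◅◅ (move ar a≢r 2≤D₁a ◅ ε) ,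
    subst (1 ≤_) (sym (moved-target D₁ a r)) (s≤s z≤n)

  record Transfer (a b : V) (t : ℕ) (D : Distribution) : Set where
    field
      result    : Distribution
      reach     : Reach D result
      gain      : result b ≡ D b + t
      unchanged : UnchangedOff a b D result

  transfer : ∀ {a b} → Adj a b → a ≢ b → ∀ t D → 2 * t ≤ D a → Transfer a b t D
  transfer ab a≢b zero D _ = record
    { result = D ; reach = ε ; gain = sym (+-identityʳ _) ; unchanged = λ _ _ _ → refl }
  transfer {a} {b} ab a≢b (suc t) D 2+2t≤Da = record
    { result    = result
    ; reach     = move ab a≢b 2≤Da ◅ reach
    ; gain      = trans gain (trans (cong (_+ t) (moved-target D a b)) (sym (+-suc (D b) t)))
    ; unchanged = λ w w≢a w≢b → trans (unchanged w w≢a w≢b) (moved-other D a b w w≢a w≢b)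
    }
    where
    2+2t≤Da′ : 2 + 2 * t ≤ D a
    2+2t≤Da′ = subst (_≤ D a) (*-suc 2 t) 2+2t≤Da
    2≤Da : 2 ≤ D a
    2≤Da = ≤-trans (m≤m+n 2 (2 * t)) 2+2t≤Da′
    2t≤rest : 2 * t ≤ moved D a b a
    2t≤rest = subst (2 * t ≤_) (sym (moved-source D a≢b))
                (subst (_≤ D a ∸ 2) (m+n∸m≡n 2 (2 * t)) (∸-monoˡ-≤ 2 2+2t≤Da′))
    open Transfer (transfer ab a≢b t (moved D a b) 2t≤rest)

record IsVertexSum {V : Set} (total : (V → ℕ) → ℕ) : Set where
  field
    total-cong   : ∀ {f g} → f ≗ g → total f ≡ total g
    total-update : ∀ {f g} a → (∀ w → w ≢ a → f w ≡ g w) → total f + g a ≡ total g + f a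

module VertexSums (G : Graph) (_≟_ : DecidableEquality (Graph.V G))
                  (isVertexSum : IsVertexSum (Graph.total G)) where
  open Graph G
  open Pebbling G
  open Override _≟_
  open Moves G _≟_
  open IsVertexSum isVertexSum

  value≤total : ∀ f a → f a ≤ total f
  value≤total f a = begin
    f a                            ≤⟨ m≤n+m (f a) (total (f [ a ≔ 0 ])) ⟩
    total (f [ a ≔ 0 ]) + f a      ≡⟨ sym (total-update a (λ w w≢a → sym (≔-off f 0 w≢a))) ⟩
    total f + (f [ a ≔ 0 ]) a      ≡⟨ cong (total f +_) (≔-at f a 0) ⟩
    total f + 0                    ≡⟨ +-identityʳ (total f) ⟩
    total f                        ∎
    where open ≤-Reasoning

  total-update₂ : ∀ {f g a b} → a ≢ b → (∀ w → w ≢ a → w ≢ b → f w ≡ g w) →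
              total f + g a + g b ≡ total g + f a + f b
  total-update₂ {f} {g} {a} {b} a≢b f≡g = begin
    total f + g a + g b      ≡⟨ cong (λ x → total f + x + g b) (sym (≔-at f a (g a))) ⟩
    total f + h a + g b      ≡⟨ cong (_+ g b) (total-update a f≡h-off-a) ⟩
    total h + f a + g b      ≡⟨ xy∙z≈xz∙y (total h) (f a) (g b) ⟩
    total h + g b + f a      ≡⟨ cong (_+ f a) (total-update b h≡g-off-b) ⟩
    total g + h b + f a      ≡⟨ cong (λ x → total g + x + f a) (≔-off f (g a) (a≢b ∘ sym)) ⟩
    total g + f b + f a      ≡⟨ xy∙z≈xz∙y (total g) (f b) (f a) ⟩
    total g + f a + f b      ∎
    where
    open ≡-Reasoning
    h : V → ℕ
    h = f [ a ≔ g a ]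
    f≡h-off-a : ∀ w → w ≢ a → f w ≡ h w
    f≡h-off-a w w≢a = sym (≔-off f (g a) w≢a)
    h≡g-off-b : ∀ w → w ≢ b → h w ≡ g w
    h≡g-off-b w w≢b = by-cases (w ≟ a)
      where
      by-cases : Dec (w ≡ a) → h w ≡ g w
      by-cases (yes refl) = ≔-at f w (g w)
      by-cases (no w≢a)   = trans (≔-off f (g a) w≢a) (f≡g w w≢a w≢b)

  total-move : ∀ {D D'} → Move D D' → suc (total D') ≡ total D
  total-move {D} {D'} mv@(a , b , _ , _ , source , target , other) =
    +-cancelʳ-≡ (D' a + suc (D b)) _ _ (begin
      suc (total D') + (D' a + suc (D b))  ≡⟨ shuffle (total D') (D' a) (D b) ⟩
      total D' + (D' a + 2) + D b        ≡⟨ cong (λ x → total D' + x + D b) source ⟩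
      total D' + D a + D b               ≡⟨ total-update₂ (move-endpoints-distinct mv) other ⟩
      total D + D' a + D' b              ≡⟨ cong (total D + D' a +_) target ⟩
      total D + D' a + suc (D b)         ≡⟨ +-assoc (total D) (D' a) (suc (D b)) ⟩
      total D + (D' a + suc (D b))       ∎)
    where
    open ≡-Reasoning
    shuffle : ∀ t x y → suc t + (x + suc y) ≡ t + (x + 2) + y
    shuffle = solve-∀

  potential : (V → ℕ → ℕ) → Distribution → ℕ
  potential ω D = total (λ w → ω w (D w))

  IsPebblingWeight : (V → ℕ → ℕ) → Set
  IsPebblingWeight ω = ∀ {a b} → Adj a b → ∀ x y → ω a x + ω b (suc y) ≤ ω a (x + 2) + ω b y

  potential-move : ∀ ω → IsPebblingWeight ω → ∀ {D D'} → Move D D' → potential ω D' ≤ potential ω D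
  potential-move ω local {D} {D'} mv@(a , b , ab , _ , source , target , other) =
    +-cancelʳ-≤ (ω a (D a) + ω b (D b)) _ _ (begin
      potential ω D' + (ω a (D a) + ω b (D b))   ≡⟨ sym (+-assoc (potential ω D') _ _) ⟩
      potential ω D' + ω a (D a) + ω b (D b)
        ≡⟨ total-update₂ (move-endpoints-distinct mv) (λ w w≢a w≢b → cong (ω w) (other w w≢a w≢b)) ⟩
      potential ω D + ω a (D' a) + ω b (D' b)    ≡⟨ +-assoc (potential ω D) _ _ ⟩
      potential ω D + (ω a (D' a) + ω b (D' b))  ≤⟨ +-monoʳ-≤ (potential ω D) after≤before ⟩
      potential ω D + (ω a (D a) + ω b (D b))    ∎)
    where
    open ≤-Reasoning
    after≤before : ω a (D' a) + ω b (D' b) ≤ ω a (D a) + ω b (D b)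
    after≤before = subst₂ (λ y x → ω a (D' a) + ω b y ≤ ω a x + ω b (D b)) (sym target) source
                     (local ab (D' a) (D b))

  potential-reach : ∀ ω → IsPebblingWeight ω → ∀ {D D'} → Reach D D' → potential ω D' ≤ potential ω D
  potential-reach ω local ε           = ≤-refl
  potential-reach ω local (mv ◅ moves) = ≤-trans (potential-reach ω local moves) (potential-move ω local mv)

IsLeast : (ℕ → Set) → ℕ → Set
IsLeast P m = P m × (∀ M → P M → m ≤ M)

module _ {P : ℕ → Set} (P? : U.Decidable P) where

  private
    least-below : ∀ N → (∀ {n} → n < N → ¬ P n) ⊎ (∃ λ m → IsLeast P m × m < N)
    least-below zero = inj₁ λ ()
    least-below (suc N) with least-below N | P? N
    ... | inj₂ (m , least , m<N) | _ = inj₂ (m , least , m<n⇒m<1+n m<N)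
    ... | inj₁ none | yes PN = inj₂ (N , (PN , λ M PM → ≮⇒≥ (λ M<N → none M<N PM)) , ≤-refl)
    ... | inj₁ none | no ¬PN = inj₁ λ n<1+N → [ none , (λ { refl → ¬PN }) ]′ (m<1+n⇒m<n∨m≡n n<1+N)

  least : ∀ {N} → P N → ∃ λ m → IsLeast P m × m ≤ N
  least {N} PN with least-below (suc N)
  ... | inj₁ none              = ⊥-elim (none ≤-refl PN)
  ... | inj₂ (m , least , m<1+N) = m , least , ≤-pred m<1+N

module Decision (G : Graph) (_≟_ : DecidableEquality (Graph.V G))
                (isVertexSum : IsVertexSum (Graph.total G))
                (adj? : Decidable (Graph.Adj G))
                (vertices : List (Graph.V G)) (∈-vertices : ∀ x → x ∈ vertices) where
  open Graph G
  open Pebbling G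
  open Override _≟_
  open Moves G _≟_
  open VertexSums G _≟_ isVertexSum
  open IsVertexSum isVertexSum

  SolvableAfterMove : V → Distribution → V × V → Set
  SolvableAfterMove r D (a , b) = Adj a b × a ≢ b × 2 ≤ D a × Solvable r (moved D a b)

  private
    solvable-with-total? : ∀ r n D → total D ≡ n → Dec (Solvable r D)
    solvable-with-total? r n D _ with 1 ≤? D r
    ... | yes 1≤Dr = yes (D , ε , 1≤Dr)
    solvable-with-total? r zero D total≡0 | no 1≰Dr = no λ where
      (_ , ε , 1≤Dr)   → 1≰Dr 1≤Dr
      (_ , mv ◅ _ , _) → 1+n≢0 (trans (total-move mv) total≡0)
    solvable-with-total? r (suc n) D total≡1+n | no 1≰Dr
      with any? after-move? (cartesianProduct vertices vertices)
      where
      after-move? : U.Decidable (SolvableAfterMove r D)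
      after-move? (a , b) with adj? a b | a ≟ b | 2 ≤? D a
      ... | no ¬ab | _        | _       = no (¬ab ∘ proj₁)
      ... | yes _  | yes a≡b  | _       = no λ (_ , a≢b , _) → a≢b a≡b
      ... | yes _  | no _     | no 2≰Da = no λ (_ , _ , 2≤Da , _) → 2≰Da 2≤Da
      ... | yes ab | no a≢b   | yes 2≤Da =
        Dec.map′ (λ solvable → ab , a≢b , 2≤Da , solvable) (proj₂ ∘ proj₂ ∘ proj₂)
          (solvable-with-total? r n (moved D a b)
            (suc-injective (trans (total-move (move ab a≢b 2≤Da)) total≡1+n)))
    ... | yes some-move =
      let ((a , b) , ab , a≢b , 2≤Da , D' , moves , 1≤D'r) = Any.satisfied some-move
      in yes (D' , move ab a≢b 2≤Da ◅ moves , 1≤D'r)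
    ... | no no-move = no λ where
      (_ , ε , 1≤Dr) → 1≰Dr 1≤Dr
      (D' , mv@(a , b , ab , 2≤Da , _) ◅ moves , 1≤D'r) →
        no-move (lose (∈-cartesianProduct⁺ (∈-vertices a) (∈-vertices b))
                      (ab , move-endpoints-distinct mv , 2≤Da ,
                       solvable-resp-≗ (move-determined mv) (D' , moves , 1≤D'r)))

  solvable? : ∀ r D → Dec (Solvable r D)
  solvable? r D = solvable-with-total? r (total D) D refl

  bounded : List V → ℕ → List Distribution
  bounded []       N = (λ _ → 0) ∷ []
  bounded (x ∷ xs) N = cartesianProductWith (λ i E → E [ x ≔ i ]) (upTo (suc N)) (bounded xs N)

  bounded-complete : ∀ xs N (D : Distribution) → (∀ x → D x ≤ N) →
                     Σ Distribution λ E → E ∈ bounded xs N × (∀ {x} → x ∈ xs → E x ≡ D x)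
  bounded-complete []       N D D≤N = _ , here refl , λ ()
  bounded-complete (x ∷ xs) N D D≤N with bounded-complete xs N D D≤N
  ... | E , E∈ , E≡D =
    E [ x ≔ D x ] ,
    ∈-cartesianProductWith⁺ (λ i E → E [ x ≔ i ]) (∈-upTo⁺ (s≤s (D≤N x))) E∈ ,
    agree
    where
    agree : ∀ {y} → y ∈ x ∷ xs → (E [ x ≔ D x ]) y ≡ D y
    agree {y} y∈ = by-cases (y ≟ x) y∈
      where
      by-cases : Dec (y ≡ x) → y ∈ x ∷ xs → (E [ x ≔ D x ]) y ≡ D y
      by-cases (yes refl) _          = ≔-at E y (D y)
      by-cases (no y≢x)   (here y≡x) = ⊥-elim (y≢x y≡x)
      by-cases (no y≢x)   (there y∈) = trans (≔-off E (D x) y≢x) (E≡D y∈)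

  allSolvable? : ∀ r N → Dec (AllSolvable r N)
  allSolvable? r N with All.all? (λ E → total E ℕ.≟ N →-dec solvable? r E) (bounded vertices N)
  ... | yes all-bounded = yes λ D total≡N →
    let (E , E∈ , E≡D) = bounded-complete vertices N D
                           (λ x → subst (D x ≤_) total≡N (value≤total D x))
        E≗D : E ≗ D
        E≗D x = E≡D (∈-vertices x)
    in solvable-resp-≗ E≗D (All.lookup all-bounded E∈ (trans (total-cong E≗D) total≡N))
  ... | no ¬all-bounded = no λ all → ¬all-bounded (All.tabulate λ {E} _ total≡N → all E total≡N)

  rootedPebblingNumber : ∀ r {N} → AllSolvable r N → ∃ λ Nr → IsRootedPebblingNumber r Nr × Nr ≤ N
  rootedPebblingNumber r = least (allSolvable? r)

-- Collecting pebbles along a chain W 0 — W 1 — ⋯ — W m with feeders X i → W (i + 1)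

module Chain (G : Graph) (_≟_ : DecidableEquality (Graph.V G))
             (W X : ℕ → Graph.V G) (m : ℕ)
             (X-adj : ∀ {i} → i < m → Graph.Adj G (X i) (W (suc i)))
             (W-adj : ∀ {i} → i < m → Graph.Adj G (W i) (W (suc i)))
             (W-distinct : ∀ {i j} → i < j → j ≤ m → W i ≢ W j)
             (X-distinct : ∀ {i j} → i < j → j < m → X i ≢ X j)
             (W≢X : ∀ {i j} → i ≤ m → j < m → W i ≢ X j) where
  open Graph G
  open Pebbling G
  open Moves G _≟_

  mass : ℕ → Distribution → ℕ
  mass j D = sumBelow j (λ i → D (W i) + D (X i))

  Outside : ℕ → V → Set
  Outside j y = (∀ {i} → i < j → W i ≢ y × X i ≢ y) × W j ≢ y

  record Raised (j t : ℕ) (D : Distribution) : Set where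
    field
      result    : Distribution
      reach     : Reach D result
      raised    : D (W j) + t ≤ result (W j)
      unchanged : ∀ y → Outside j y → result y ≡ D y

  unraised : ∀ {j D} → Raised j 0 D
  unraised = record { result = _ ; reach = ε ; raised = ≤-reflexive (+-identityʳ _) ; unchanged = λ _ _ → refl }

  outside-pred : ∀ {j y} → Outside (suc j) y → Outside j y
  outside-pred (before , _) = before ∘ m<n⇒m<1+n , proj₁ (before ≤-refl)

  next-outside : ∀ {j} → j < m → Outside j (W (suc j))
  next-outside j<m =
    (λ i<j → W-distinct (m<n⇒m<1+n i<j) j<m , W≢X j<m (<-trans i<j j<m) ∘ sym) ,
    W-distinct ≤-refl j<m

  mass-unchanged : ∀ j {D D'} → (∀ {i} → i < j → D' (W i) ≡ D (W i) × D' (X i) ≡ D (X i)) →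
                   mass j D' ≡ mass j D
  mass-unchanged j same = sumBelow-cong j λ i<j → cong₂ _+_ (proj₁ (same i<j)) (proj₂ (same i<j))

  raise-via-feeder : ∀ {j t D} → j < m → (2≤X : 2 ≤ D (X j)) →
                     Raised (suc j) t (moved D (X j) (W (suc j))) → Raised (suc j) (suc t) D
  raise-via-feeder {j} {t} {D} j<m 2≤X r = record
    { result    = result
    ; reach     = move (X-adj j<m) X≢W 2≤X ◅ reach
    ; raised    = ≤-trans (≤-reflexive (+-suc (D (W (suc j))) t))
                    (subst (λ z → z + t ≤ result (W (suc j))) (moved-target D (X j) (W (suc j))) raised)
    ; unchanged = λ y (before , W≢y) →
        trans (unchanged y (before , W≢y)) (moved-other D _ _ y (proj₂ (before ≤-refl) ∘ sym) (W≢y ∘ sym))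
    }
    where
    open Raised r
    X≢W : X j ≢ W (suc j)
    X≢W = W≢X j<m j<m ∘ sym

  raise-via-predecessor : ∀ {j s t D} → j < m → (r : Raised j s D) → 2 * t ≤ D (W j) + s →
                          Raised (suc j) t D
  raise-via-predecessor {j} {s} {t} {D} j<m r 2t≤ = record
    { result    = T.result
    ; reach     = reach ◅◅ T.reach
    ; raised    = ≤-reflexive (trans (cong (_+ t) (sym (unchanged _ (next-outside j<m)))) (sym T.gain))
    ; unchanged = λ y out@(before , W≢y) →
        trans (T.unchanged y (proj₁ (before ≤-refl) ∘ sym) (W≢y ∘ sym)) (unchanged y (outside-pred out))
    }
    where
    open Raised r
    module T = Transfer (transfer (W-adj j<m) (W-distinct ≤-refl j<m) t result (≤-trans 2t≤ raised))

  mass-after-feeding : ∀ {j D} → j < m → 2 ≤ D (X j) →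
                       mass (suc j) (moved D (X j) (W (suc j))) + 2 ≡ mass (suc j) D
  mass-after-feeding {j} {D} j<m 2≤X = begin
    mass j D' + (D' (W j) + D' (X j)) + 2
      ≡⟨ cong₂ (λ a b → a + (b + D' (X j)) + 2) (mass-unchanged j {D} {D'} prefix) W-same ⟩
    mass j D + (D (W j) + D' (X j)) + 2     ≡⟨ rearrange (mass j D) (D (W j)) (D' (X j)) ⟩
    mass j D + (D (W j) + (D' (X j) + 2))   ≡⟨ cong (λ z → mass j D + (D (W j) + z)) X-restored ⟩
    mass j D + (D (W j) + D (X j))          ∎
    where
    open ≡-Reasoning
    D' : Distribution
    D' = moved D (X j) (W (suc j))
    rearrange : ∀ a b c → a + (b + c) + 2 ≡ a + (b + (c + 2))
    rearrange = solve-∀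
    X≢W : X j ≢ W (suc j)
    X≢W = W≢X j<m j<m ∘ sym
    prefix : ∀ {i} → i < j → D' (W i) ≡ D (W i) × D' (X i) ≡ D (X i)
    prefix {i} i<j =
      moved-other D _ _ (W i) (W≢X (<⇒≤ (<-trans i<j j<m)) j<m) (W-distinct (m<n⇒m<1+n i<j) j<m) ,
      moved-other D _ _ (X i) (X-distinct i<j j<m) (W≢X j<m (<-trans i<j j<m) ∘ sym)
    W-same : D' (W j) ≡ D (W j)
    W-same = moved-other D _ _ (W j) (W≢X (<⇒≤ j<m) j<m) (W-distinct ≤-refl j<m)
    X-restored : D' (X j) + 2 ≡ D (X j)
    X-restored = trans (cong (_+ 2) (moved-source D X≢W)) (m∸n+n≡m 2≤X)

  -- W (j + 1) is fed from X j while X j holds two pebbles; the rest comes from W j,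
  -- first topped up to twice the missing amount.
  raise-step : ∀ {j} → j < m → (∀ t D → t * 2 ^ j + j ≤ mass j D → Raised j t D) →
               ∀ t D → t * 2 ^ suc j + suc j ≤ mass (suc j) D → Raised (suc j) t D
  raise-step j<m raise-j zero D _ = unraised
  raise-step {j} j<m raise-j (suc t) D enough with 2 ≤? D (X j) | 2 * suc t ≤? D (W j)
  ... | yes 2≤X | _ =
    raise-via-feeder j<m 2≤X
      (raise-step j<m raise-j t _
        (peel-one {t = t} {P = 2 ^ suc j} (*-monoʳ-≤ 2 (m^n>0 2 j)) enough (mass-after-feeding j<m 2≤X)))
  ... | no _ | yes 2t≤W =
    raise-via-predecessor j<m unraised (subst (2 * suc t ≤_) (sym (+-identityʳ _)) 2t≤W)
  ... | no X<2 | no 2t≰W =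
    raise-via-predecessor j<m
      (raise-j (2 * suc t ∸ D (W j)) D (top-up {t = suc t} W+missing≡2t (≤-pred (≰⇒> X<2)) enough))
      (≤-reflexive (sym W+missing≡2t))
    where
    W+missing≡2t : D (W j) + (2 * suc t ∸ D (W j)) ≡ 2 * suc t
    W+missing≡2t = m+[n∸m]≡n (<⇒≤ (≰⇒> 2t≰W))

  -- Every feeder may strand a single pebble, whence the additive j.
  raise : ∀ j → j ≤ m → ∀ t D → t * 2 ^ j + j ≤ mass j D → Raised j t D
  raise zero    _   zero    D _  = unraised
  raise zero    _   (suc t) D ()
  raise (suc j) j<m           = raise-step j<m (raise j (<⇒≤ j<m))

  gather : ∀ {j} → j ≤ m → ∀ t D → t * 2 ^ j + j ≤ mass j D + D (W j) →
           Σ Distribution λ D' → Reach D D' × t ≤ D' (W j)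
  gather {j} j≤m t D enough with t ≤? D (W j)
  ... | yes t≤W = D , ε , t≤W
  ... | no t≰W = result , reach , subst (_≤ result (W j)) W+missing≡t raised
    where
    W+missing≡t : D (W j) + (t ∸ D (W j)) ≡ t
    W+missing≡t = m+[n∸m]≡n (<⇒≤ (≰⇒> t≰W))
    open Raised (raise j j≤m (t ∸ D (W j)) D
                  (scaled-cancel (m^n>0 2 j) (subst (λ z → z * 2 ^ j + j ≤ _) (sym W+missing≡t) enough)))

module MiddleGraph (k : ℕ) where
  open Pebbling (MidPathMinusEnds k)

  _≟_ : DecidableEquality (MVert k)
  v i ≟ v j = Dec.map′ (cong v) (λ { refl → refl }) (i Fin.≟ j)
  u i ≟ u j = Dec.map′ (cong u) (λ { refl → refl }) (i Fin.≟ j)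
  v _ ≟ u _ = no λ ()
  u _ ≟ v _ = no λ ()

  adj? : Decidable (MAdj k)
  adj? (v i) (v j) = no λ ()
  adj? (v i) (u j) with toℕ j ℕ.≟ toℕ i | toℕ j ℕ.≟ suc (toℕ i)
  ... | yes j≡i | _       = yes (vu-left i j j≡i)
  ... | no _    | yes j≡i+1 = yes (vu-right i j j≡i+1)
  ... | no j≢i  | no j≢i+1 = no λ { (vu-left _ _ j≡i) → j≢i j≡i ; (vu-right _ _ j≡i+1) → j≢i+1 j≡i+1 }
  adj? (u j) (v i) with toℕ j ℕ.≟ toℕ i | toℕ j ℕ.≟ suc (toℕ i)
  ... | yes j≡i | _       = yes (uv-left i j j≡i)
  ... | no _    | yes j≡i+1 = yes (uv-right i j j≡i+1)
  ... | no j≢i  | no j≢i+1 = no λ { (uv-left _ _ j≡i) → j≢i j≡i ; (uv-right _ _ j≡i+1) → j≢i+1 j≡i+1 }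
  adj? (u i) (u j) with toℕ j ℕ.≟ suc (toℕ i) | toℕ i ℕ.≟ suc (toℕ j)
  ... | yes j≡i+1 | _       = yes (uu-up i j j≡i+1)
  ... | no _      | yes i≡j+1 = yes (uu-down i j i≡j+1)
  ... | no j≢i+1  | no i≢j+1 = no λ { (uu-up _ _ j≡i+1) → j≢i+1 j≡i+1 ; (uu-down _ _ i≡j+1) → i≢j+1 i≡j+1 }

  vertices : List (MVert k)
  vertices = tabulate v ++ tabulate u

  ∈-vertices : ∀ x → x ∈ vertices
  ∈-vertices (v i) = ∈-++⁺ˡ (∈-tabulate⁺ {f = v} i)
  ∈-vertices (u j) = ∈-++⁺ʳ (tabulate v) (∈-tabulate⁺ {f = u} j)

  vSum uSum : (MVert k → ℕ) → ℕ
  vSum h = sum (map (h ∘ v) (allFin k))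
  uSum h = sum (map (h ∘ u) (allFin (suc k)))

  mTotal-isVertexSum : IsVertexSum (mTotal k)
  mTotal-isVertexSum = record { total-cong = total-cong ; total-update = total-update }
    where
    total-cong : ∀ {f g} → f ≗ g → mTotal k f ≡ mTotal k g
    total-cong f≗g = cong₂ _+_ (cong sum (map-cong (f≗g ∘ v) (allFin k)))
                               (cong sum (map-cong (f≗g ∘ u) (allFin (suc k))))
    total-update : ∀ {f g} a → (∀ w → w ≢ a → f w ≡ g w) → mTotal k f + g a ≡ mTotal k g + f a
    total-update {f} {g} (v i) f≡g = begin
      vSum f + uSum f + g (v i)   ≡⟨ xy∙z≈xz∙y (vSum f) (uSum f) (g (v i)) ⟩
      vSum f + g (v i) + uSum f   ≡⟨ cong₂ _+_ v-part u-part ⟩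
      vSum g + f (v i) + uSum g   ≡⟨ xy∙z≈xz∙y (vSum g) (f (v i)) (uSum g) ⟩
      vSum g + uSum g + f (v i)   ∎
      where
      open ≡-Reasoning
      v-part : vSum f + g (v i) ≡ vSum g + f (v i)
      v-part = subst₂ (λ x y → x + g (v i) ≡ y + f (v i))
                 (sym (sum-allFin k (f ∘ v))) (sym (sum-allFin k (g ∘ v)))
                 (sum-tabulate-update k (f ∘ v) (g ∘ v) i (λ j j≢i → f≡g (v j) (j≢i ∘ λ { refl → refl })))
      u-part : uSum f ≡ uSum g
      u-part = cong sum (map-cong (λ j → f≡g (u j) λ ()) (allFin (suc k)))
    total-update {f} {g} (u j) f≡g = begin
      vSum f + uSum f + g (u j)   ≡⟨ +-assoc (vSum f) (uSum f) (g (u j)) ⟩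
      vSum f + (uSum f + g (u j)) ≡⟨ cong₂ _+_ v-part u-part ⟩
      vSum g + (uSum g + f (u j)) ≡⟨ sym (+-assoc (vSum g) (uSum g) (f (u j))) ⟩
      vSum g + uSum g + f (u j)   ∎
      where
      open ≡-Reasoning
      v-part : vSum f ≡ vSum g
      v-part = cong sum (map-cong (λ i → f≡g (v i) λ ()) (allFin k))
      u-part : uSum f + g (u j) ≡ uSum g + f (u j)
      u-part = subst₂ (λ x y → x + g (u j) ≡ y + f (u j))
                 (sym (sum-allFin (suc k) (f ∘ u))) (sym (sum-allFin (suc k) (g ∘ u)))
                 (sum-tabulate-update (suc k) (f ∘ u) (g ∘ u) j (λ i i≢j → f≡g (u i) (i≢j ∘ λ { refl → refl })))

  -- Vertices by position along the path; out-of-range positions give u 0, a junk value never used.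
  uAt vAt : ℕ → MVert k
  uAt j with j <? suc k
  ... | yes j<1+k = u (Fin.fromℕ< j<1+k)
  ... | no _      = u Fin.zero
  vAt i with i <? k
  ... | yes i<k = v (Fin.fromℕ< i<k)
  ... | no _    = u Fin.zero

  uAt-inRange : ∀ {j} → j ≤ k → Σ (Fin (suc k)) λ f → toℕ f ≡ j × uAt j ≡ u f
  uAt-inRange {j} j≤k with j <? suc k
  ... | yes j<1+k = Fin.fromℕ< j<1+k , Fin.toℕ-fromℕ< j<1+k , refl
  ... | no j≮1+k  = ⊥-elim (j≮1+k (s≤s j≤k))

  vAt-inRange : ∀ {i} → i < k → Σ (Fin k) λ f → toℕ f ≡ i × vAt i ≡ v f
  vAt-inRange {i} i<k with i <? k
  ... | yes i<k = Fin.fromℕ< i<k , Fin.toℕ-fromℕ< i<k , refl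
  ... | no i≮k  = ⊥-elim (i≮k i<k)

  uAt-toℕ : ∀ j → uAt (toℕ j) ≡ u j
  uAt-toℕ j with uAt-inRange (≤-pred (Fin.toℕ<n j))
  ... | f , f≡j , eq = trans eq (cong u (Fin.toℕ-injective f≡j))

  vAt-toℕ : ∀ i → vAt (toℕ i) ≡ v i
  vAt-toℕ i with vAt-inRange (Fin.toℕ<n i)
  ... | f , f≡i , eq = trans eq (cong v (Fin.toℕ-injective f≡i))

  uAt-injective : ∀ {i j} → i ≤ k → j ≤ k → uAt i ≡ uAt j → i ≡ j
  uAt-injective i≤k j≤k eq with uAt-inRange i≤k | uAt-inRange j≤k
  ... | f , refl , eqf | g , refl , eqg with trans (sym eqf) (trans eq eqg)
  ... | refl = refl

  vAt-injective : ∀ {i j} → i < k → j < k → vAt i ≡ vAt j → i ≡ j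
  vAt-injective i<k j<k eq with vAt-inRange i<k | vAt-inRange j<k
  ... | f , refl , eqf | g , refl , eqg with trans (sym eqf) (trans eq eqg)
  ... | refl = refl

  uAt≢vAt : ∀ {i j} → i ≤ k → j < k → uAt i ≢ vAt j
  uAt≢vAt i≤k j<k eq with uAt-inRange i≤k | vAt-inRange j<k
  ... | f , _ , eqf | g , _ , eqg with trans (sym eqf) (trans eq eqg)
  ... | ()

  vAt-adj-uAt : ∀ {n} → n < k → MAdj k (vAt n) (uAt n)
  vAt-adj-uAt n<k with vAt-inRange n<k | uAt-inRange (<⇒≤ n<k)
  ... | i , refl , eqi | j , j≡i , eqj rewrite eqi | eqj = vu-left i j j≡i

  vAt-adj-uAt-suc : ∀ {n} → n < k → MAdj k (vAt n) (uAt (suc n))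
  vAt-adj-uAt-suc n<k with vAt-inRange n<k | uAt-inRange n<k
  ... | i , refl , eqi | j , j≡i+1 , eqj rewrite eqi | eqj = vu-right i j j≡i+1

  uAt-adj-uAt-suc : ∀ {n} → n < k → MAdj k (uAt n) (uAt (suc n))
  uAt-adj-uAt-suc n<k with uAt-inRange (<⇒≤ n<k) | uAt-inRange n<k
  ... | i , refl , eqi | j , j≡i+1 , eqj rewrite eqi | eqj = uu-up i j j≡i+1

  uAt-suc-adj-uAt : ∀ {n} → n < k → MAdj k (uAt (suc n)) (uAt n)
  uAt-suc-adj-uAt n<k with uAt-inRange (<⇒≤ n<k) | uAt-inRange n<k
  ... | j , refl , eqj | i , i≡j+1 , eqi rewrite eqi | eqj = uu-down i j i≡j+1

  uAt-adj-v : ∀ i → MAdj k (uAt (toℕ i)) (v i)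
  uAt-adj-v i with uAt-inRange (<⇒≤ (Fin.toℕ<n i))
  ... | j , j≡i , eqj rewrite eqj = uv-left i j j≡i

  uAt-suc-adj-v : ∀ i → MAdj k (uAt (suc (toℕ i))) (v i)
  uAt-suc-adj-v i with uAt-inRange (Fin.toℕ<n i)
  ... | j , j≡i+1 , eqj rewrite eqj = uv-right i j j≡i+1

  k∸i≡1+k∸[1+i] : ∀ {i} → i < k → k ∸ i ≡ suc (k ∸ suc i)
  k∸i≡1+k∸[1+i] {i} i<k = +-∸-assoc 1 {k} {suc i} i<k

  k∸[1+i]<k : ∀ {i} → i < k → k ∸ suc i < k
  k∸[1+i]<k i<k = ∸-monoʳ-< z<s i<k

  module Left = Chain (MidPathMinusEnds k) _≟_ uAt vAt k
    vAt-adj-uAt-suc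
    uAt-adj-uAt-suc
    (λ i<j j≤k → <⇒≢ i<j ∘ uAt-injective (≤-trans (<⇒≤ i<j) j≤k) j≤k)
    (λ i<j j<k → <⇒≢ i<j ∘ vAt-injective (<-trans i<j j<k) j<k)
    uAt≢vAt

  module Right = Chain (MidPathMinusEnds k) _≟_ (λ i → uAt (k ∸ i)) (λ i → vAt (k ∸ suc i)) k
    (λ i<k → vAt-adj-uAt (k∸[1+i]<k i<k))
    (λ {i} i<k → subst (λ n → MAdj k (uAt n) (uAt (k ∸ suc i))) (sym (k∸i≡1+k∸[1+i] i<k))
                   (uAt-suc-adj-uAt (k∸[1+i]<k i<k)))
    (λ {i} {j} i<j j≤k → <⇒≢ i<j ∘ ∸-cancelˡ-≡ (≤-trans (<⇒≤ i<j) j≤k) j≤k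
                           ∘ uAt-injective (m∸n≤m k i) (m∸n≤m k j))
    (λ {i} {j} i<j j<k → <⇒≢ i<j ∘ suc-injective ∘ ∸-cancelˡ-≡ (<-trans i<j j<k) j<k
                           ∘ vAt-injective (k∸[1+i]<k (<-trans i<j j<k)) (k∸[1+i]<k j<k))
    (λ {i} _ j<k → uAt≢vAt (m∸n≤m k i) (k∸[1+i]<k j<k))

  mTotal-sumBelow : ∀ D → mTotal k D ≡ sumBelow k (D ∘ vAt) + sumBelow (suc k) (D ∘ uAt)
  mTotal-sumBelow D = cong₂ _+_
    (trans (sum-allFin k (D ∘ v)) (sum-tabulate k (D ∘ v) (D ∘ vAt) (λ i → cong D (sym (vAt-toℕ i)))))
    (trans (sum-allFin (suc k) (D ∘ u)) (sum-tabulate (suc k) (D ∘ u) (D ∘ uAt) (λ j → cong D (sym (uAt-toℕ j)))))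

  mTotal-split : ∀ p q → p + q ≡ k → ∀ D → mTotal k D ≡ Left.mass p D + D (uAt p) + Right.mass q D
  mTotal-split p q p+q≡k D = begin
    mTotal k D                                                    ≡⟨ mTotal-sumBelow D ⟩
    sumBelow k (D ∘ vAt) + sumBelow (suc k) (D ∘ uAt)
      ≡⟨ cong (λ n → sumBelow n (D ∘ vAt) + sumBelow (suc n) (D ∘ uAt)) (sym p+q≡k) ⟩
    sumBelow (p + q) (D ∘ vAt) + sumBelow (suc p + q) (D ∘ uAt)
      ≡⟨ cong₂ _+_ (sumBelow-split p q (D ∘ vAt)) (sumBelow-split (suc p) q (D ∘ uAt)) ⟩
    A + B + (C + E + F)                                           ≡⟨ rearrange A B C E F ⟩
    C + A + E + (F + B)                                           ≡⟨ sym (cong₂ (λ x y → x + E + y) left right) ⟩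
    Left.mass p D + E + Right.mass q D                            ∎
    where
    open ≡-Reasoning
    A B C E F : ℕ
    A = sumBelow p (D ∘ vAt)
    B = sumBelow q (λ i → D (vAt (p + i)))
    C = sumBelow p (D ∘ uAt)
    E = D (uAt p)
    F = sumBelow q (λ i → D (uAt (suc p + i)))
    rearrange : ∀ A B C E F → A + B + (C + E + F) ≡ C + A + E + (F + B)
    rearrange = solve-∀
    left : Left.mass p D ≡ C + A
    left = sumBelow-+ p (D ∘ uAt) (D ∘ vAt)
    v-index : ∀ {i} → i < q → k ∸ suc i ≡ p + (q ∸ suc i)
    v-index {i} i<q = trans (cong (_∸ suc i) (sym p+q≡k)) (+-∸-assoc p i<q)
    u-index : ∀ {i} → i < q → k ∸ i ≡ suc p + (q ∸ suc i)
    u-index {i} i<q = begin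
      k ∸ i                  ≡⟨ cong (_∸ i) (sym p+q≡k) ⟩
      p + q ∸ i              ≡⟨ +-∸-assoc p (<⇒≤ i<q) ⟩
      p + (q ∸ i)            ≡⟨ cong (p +_) (+-∸-assoc 1 {q} {suc i} i<q) ⟩
      p + suc (q ∸ suc i)    ≡⟨ +-suc p _ ⟩
      suc p + (q ∸ suc i)    ∎
    right : Right.mass q D ≡ F + B
    right = begin
      Right.mass q D
        ≡⟨ sumBelow-cong q (λ i<q → cong₂ _+_ (cong (D ∘ uAt) (u-index i<q)) (cong (D ∘ vAt) (v-index i<q))) ⟩
      sumBelow q (λ i → D (uAt (suc p + (q ∸ suc i))) + D (vAt (p + (q ∸ suc i))))
        ≡⟨ sumBelow-+ q _ _ ⟩
      sumBelow q (λ i → D (uAt (suc p + (q ∸ suc i)))) + sumBelow q (λ i → D (vAt (p + (q ∸ suc i))))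
        ≡⟨ cong₂ _+_ (sumBelow-reverse q (λ i → D (uAt (suc p + i))))
                     (sumBelow-reverse q (λ i → D (vAt (p + i)))) ⟩
      F + B ∎

  uAt≢v : ∀ n i → uAt n ≢ v i
  uAt≢v n i with n <? suc k
  ... | yes _ = λ ()
  ... | no _  = λ ()

  right-end : ∀ {p q} → p + q ≡ k → k ∸ q ≡ p
  right-end {p} {q} p+q≡k = trans (cong (_∸ q) (sym p+q≡k)) (m+n∸n≡m p q)

  open Moves (MidPathMinusEnds k) _≟_ using (solvable-from-neighbour)

  solvable-at-uAt : ∀ {p q} → p + q ≡ k → ∀ D → mTotal k D ≡ 2 ^ k + k → Solvable (uAt p) D
  solvable-at-uAt {p} {q} p+q≡k D total≡
    with 1 * 2 ^ p + p ≤? Left.mass p D + D (uAt p) | 1 * 2 ^ q + q ≤? Right.mass q D + D (uAt (k ∸ q))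
  ... | yes enough | _ = Left.gather (subst (p ≤_) p+q≡k (m≤m+n p q)) 1 D enough
  ... | no _ | yes enough =
    subst (λ w → Solvable (uAt w) D) (right-end p+q≡k)
      (Right.gather (subst (q ≤_) p+q≡k (m≤n+m q p)) 1 D enough)
  ... | no short-left | no short-right =
    ⊥-elim (<⇒≢ (short-halves-u-root p q shared (≰⇒> short-left) (≰⇒> short-right))
                (trans total≡ (cong (λ n → 2 ^ n + n) (sym p+q≡k))))
    where
    open ≡-Reasoning
    shared : mTotal k D + D (uAt p) ≡ Left.mass p D + D (uAt p) + (Right.mass q D + D (uAt (k ∸ q)))
    shared = begin
      mTotal k D + D (uAt p)                                ≡⟨ cong (_+ D (uAt p)) (mTotal-split p q p+q≡k D) ⟩
      Left.mass p D + D (uAt p) + Right.mass q D + D (uAt p) ≡⟨ +-assoc (Left.mass p D + D (uAt p)) _ _ ⟩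
      Left.mass p D + D (uAt p) + (Right.mass q D + D (uAt p))
        ≡⟨ cong (λ n → Left.mass p D + D (uAt p) + (Right.mass q D + D (uAt n))) (sym (right-end p+q≡k)) ⟩
      Left.mass p D + D (uAt p) + (Right.mass q D + D (uAt (k ∸ q))) ∎

  solvable-at-u : ∀ j D → mTotal k D ≡ 2 ^ k + k → Solvable (u j) D
  solvable-at-u j D =
    subst (λ w → Solvable w D) (uAt-toℕ j) ∘ solvable-at-uAt (m+[n∸m]≡n (≤-pred (Fin.toℕ<n j))) D

  solvable-at-empty-v : ∀ i {q} → suc (toℕ i) + q ≡ k → ∀ D → mTotal k D ≡ 2 ^ k + k → D (v i) ≡ 0 →
                        Solvable (v i) D
  solvable-at-empty-v i {q} 1+i+q≡k D total≡ vi-empty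
    with 2 * 2 ^ toℕ i + toℕ i ≤? Left.mass (toℕ i) D + D (uAt (toℕ i))
       | 2 * 2 ^ q + q ≤? Right.mass q D + D (uAt (k ∸ q))
  ... | yes enough | _ =
    let D' , reach , 2≤ = Left.gather (<⇒≤ (Fin.toℕ<n i)) 2 D enough
    in solvable-from-neighbour (uAt-adj-v i) (uAt≢v _ i) reach 2≤
  ... | no _ | yes enough =
    let D' , reach , 2≤ = Right.gather (subst (q ≤_) 1+i+q≡k (m≤n+m q _)) 2 D enough
    in solvable-from-neighbour (subst (λ w → MAdj k (uAt w) (v i)) (sym (right-end 1+i+q≡k)) (uAt-suc-adj-v i))
         (uAt≢v _ i) reach 2≤
  ... | no short-left | no short-right =
    ⊥-elim (<⇒≢ (short-halves-v-root (toℕ i) q split (≰⇒> short-left) (≰⇒> short-right))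
                (trans total≡ (cong (λ n → 2 ^ n + n) (sym 1+i+q≡k))))
    where
    open ≡-Reasoning
    Lm Rm Dᵢ Dᵢ₊₁ : ℕ
    Lm   = Left.mass (toℕ i) D
    Rm   = Right.mass q D
    Dᵢ   = D (uAt (toℕ i))
    Dᵢ₊₁ = D (uAt (k ∸ q))
    rearrange : ∀ a b c d → a + (b + 0) + c + d ≡ a + b + (d + c)
    rearrange = solve-∀
    split : mTotal k D ≡ Lm + Dᵢ + (Rm + Dᵢ₊₁)
    split = begin
      mTotal k D                                          ≡⟨ mTotal-split (suc (toℕ i)) q 1+i+q≡k D ⟩
      Lm + (Dᵢ + D (vAt (toℕ i))) + D (uAt (suc (toℕ i))) + Rm
        ≡⟨ cong₂ (λ x y → Lm + (Dᵢ + x) + D (uAt y) + Rm)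
                 (trans (cong D (vAt-toℕ i)) vi-empty) (sym (right-end 1+i+q≡k)) ⟩
      Lm + (Dᵢ + 0) + Dᵢ₊₁ + Rm                           ≡⟨ rearrange Lm Dᵢ Dᵢ₊₁ Rm ⟩
      Lm + Dᵢ + (Rm + Dᵢ₊₁)                               ∎

  solvable-at-v : ∀ i D → mTotal k D ≡ 2 ^ k + k → Solvable (v i) D
  solvable-at-v i D total≡ with 1 ≤? D (v i)
  ... | yes 1≤D = D , ε , 1≤D
  ... | no 1≰D  = solvable-at-empty-v i (m+[n∸m]≡n (Fin.toℕ<n i)) D total≡ (n<1⇒n≡0 (≰⇒> 1≰D))

  2^[k∸]-antitone : ∀ {i j} → i ≤ j → 2 ^ (k ∸ j) ≤ 2 ^ (k ∸ i)
  2^[k∸]-antitone i≤j = ^-monoʳ-≤ 2 (∸-monoʳ-≤ k i≤j)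

  rate : MVert k → ℕ
  rate (v i) = 2 ^ (k ∸ toℕ i)
  rate (u j) = 2 ^ (k ∸ toℕ j)

  -- Pebbles on v_i count only in pairs, so the lone pebbles of `witness` below carry no weight.
  weight : MVert k → ℕ → ℕ
  weight (v i) d = ⌊ d /2⌋ * rate (v i)
  weight (u j) d = d * rate (u j)

  release : MVert k → ℕ
  release (v i) = rate (v i)
  release (u j) = 2 * rate (u j)

  weight-send : ∀ a x → weight a x + release a ≡ weight a (x + 2)
  weight-send (v i) x = begin
    ⌊ x /2⌋ * rate (v i) + rate (v i)   ≡⟨ +-comm (⌊ x /2⌋ * rate (v i)) (rate (v i)) ⟩
    suc ⌊ x /2⌋ * rate (v i)            ≡⟨ cong (λ z → ⌊ z /2⌋ * rate (v i)) (+-comm 2 x) ⟩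
    ⌊ x + 2 /2⌋ * rate (v i)            ∎
    where open ≡-Reasoning
  weight-send (u j) x = sym (*-distribʳ-+ (rate (u j)) x 2)

  weight-receive : ∀ b y → weight b (suc y) ≤ weight b y + rate b
  weight-receive (v i) y = begin
    ⌊ suc y /2⌋ * rate (v i)            ≤⟨ *-monoˡ-≤ (rate (v i)) (⌊n/2⌋-mono (n≤1+n (suc y))) ⟩
    suc ⌊ y /2⌋ * rate (v i)            ≡⟨ +-comm (rate (v i)) _ ⟩
    ⌊ y /2⌋ * rate (v i) + rate (v i)   ∎
    where open ≤-Reasoning
  weight-receive (u j) y = ≤-reflexive (+-comm (rate (u j)) (y * rate (u j)))

  rate≤release : ∀ {a b} → MAdj k a b → rate b ≤ release a
  rate≤release (vu-left i j j≡i)    = 2^[k∸]-antitone (≤-reflexive (sym j≡i))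
  rate≤release (vu-right i j j≡i+1) = 2^[k∸]-antitone (≤-trans (n≤1+n _) (≤-reflexive (sym j≡i+1)))
  rate≤release (uv-left i j j≡i)    = ≤-trans (2^[k∸]-antitone (≤-reflexive j≡i)) (m≤m+n _ _)
  rate≤release (uv-right i j j≡i+1) =
    ≤-reflexive (trans (cong (2 ^_) (k∸i≡1+k∸[1+i] (Fin.toℕ<n i)))
                       (cong (λ n → 2 * 2 ^ (k ∸ n)) (sym j≡i+1)))
  rate≤release (uu-up i j j≡i+1)    =
    ≤-trans (2^[k∸]-antitone (≤-trans (n≤1+n _) (≤-reflexive (sym j≡i+1)))) (m≤m+n _ _)
  rate≤release (uu-down i j i≡j+1)  =
    ≤-reflexive (trans (cong (2 ^_) (k∸i≡1+k∸[1+i] j<k)) (cong (λ n → 2 * 2 ^ (k ∸ n)) (sym i≡j+1)))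
    where
    j<k : toℕ j < k
    j<k = subst (_≤ k) i≡j+1 (≤-pred (Fin.toℕ<n i))

  open VertexSums (MidPathMinusEnds k) _≟_ mTotal-isVertexSum

  weight-isPebblingWeight : IsPebblingWeight weight
  weight-isPebblingWeight {a} {b} ab x y = begin
    weight a x + weight b (suc y)              ≤⟨ +-monoʳ-≤ (weight a x) (weight-receive b y) ⟩
    weight a x + (weight b y + rate b)         ≤⟨ +-monoʳ-≤ (weight a x) (+-monoʳ-≤ (weight b y) (rate≤release ab)) ⟩
    weight a x + (weight b y + release a)      ≡⟨ rearrange (weight a x) (weight b y) (release a) ⟩
    weight a x + release a + weight b y        ≡⟨ cong (_+ weight b y) (weight-send a x) ⟩
    weight a (x + 2) + weight b y              ∎
    where
    open ≤-Reasoning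
    rearrange : ∀ p q r → p + (q + r) ≡ p + r + q
    rearrange = solve-∀

  open Override _≟_

  top : MVert k
  top = u (Fin.fromℕ k)

  singles : ℕ → Distribution
  singles m (v i) = one-if-below m (toℕ i)
  singles m (u _) = 0

  witness : ℕ → ℕ → Distribution
  witness c m = singles m [ top ≔ c ]

  mTotal-singles : ∀ {m} → m ≤ k → mTotal k (singles m) ≡ m
  mTotal-singles {m} m≤k = trans (cong₂ _+_ v-part u-part) (+-identityʳ m)
    where
    v-part : vSum (singles m) ≡ m
    v-part = trans (sum-allFin k (singles m ∘ v))
               (trans (sum-tabulate k _ (one-if-below m) (λ _ → refl)) (sumBelow-one-if-below m≤k))
    u-part : uSum (singles m) ≡ 0
    u-part = trans (sum-allFin (suc k) (singles m ∘ u))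
               (trans (sum-tabulate (suc k) _ (λ _ → 0) (λ _ → refl)) (sumBelow-zero (suc k) (λ _ → refl)))

  mTotal-zero : mTotal k (λ _ → 0) ≡ 0
  mTotal-zero = mTotal-singles z≤n

  mTotal-witness : ∀ c {m} → m ≤ k → mTotal k (witness c m) ≡ m + c
  mTotal-witness c {m} m≤k = +-cancelʳ-≡ 0 _ _ (begin
    mTotal k (witness c m) + 0                  ≡⟨ total-update top (λ w w≢top → ≔-off (singles m) c w≢top) ⟩
    mTotal k (singles m) + witness c m top      ≡⟨ cong₂ _+_ (mTotal-singles m≤k) (≔-at (singles m) top c) ⟩
    m + c                                       ≡⟨ +-identityʳ (m + c) ⟨
    m + c + 0                                   ∎)
    where
    open ≡-Reasoning
    open IsVertexSum mTotal-isVertexSum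

  potential-witness : ∀ c m → potential weight (witness c m) ≡ c
  potential-witness c m = begin
    potential weight (witness c m)                 ≡⟨ +-identityʳ _ ⟨
    potential weight (witness c m) + 0             ≡⟨ total-update top worthless-off-top ⟩
    mTotal k (λ _ → 0) + weight top (witness c m top)
      ≡⟨ cong₂ (λ x y → x + weight top y) mTotal-zero (≔-at (singles m) top c) ⟩
    c * 2 ^ (k ∸ toℕ (Fin.fromℕ k))                ≡⟨ cong (λ n → c * 2 ^ (k ∸ n)) (Fin.toℕ-fromℕ k) ⟩
    c * 2 ^ (k ∸ k)                                ≡⟨ cong (λ n → c * 2 ^ n) (n∸n≡0 k) ⟩
    c * 1                                          ≡⟨ *-identityʳ c ⟩
    c                                              ∎
    where
    open ≡-Reasoning
    open IsVertexSum mTotal-isVertexSum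
    worthless-off-top : ∀ w → w ≢ top → weight w (witness c m w) ≡ 0
    worthless-off-top (v i) _     = trans (cong (λ d → ⌊ d /2⌋ * rate (v i)) (≔-off (singles m) {top} {v i} c λ ()))
                                          (cong (_* rate (v i)) (⌊one-if-below/2⌋≡0 m (toℕ i)))
    worthless-off-top (u j) u≢top = cong (_* rate (u j)) (≔-off (singles m) c u≢top)

  witness-unsolvable : ∀ {c} → c < 2 ^ k → ∀ m → ¬ Solvable (u Fin.zero) (witness c m)
  witness-unsolvable {c} c<2^k m (D' , reach , 1≤D') = <⇒≱ c<2^k (begin
    2 ^ k                              ≡⟨ *-identityˡ (2 ^ k) ⟨
    1 * 2 ^ k                          ≤⟨ *-monoˡ-≤ (2 ^ k) 1≤D' ⟩
    weight (u Fin.zero) (D' (u Fin.zero)) ≤⟨ value≤total (λ w → weight w (D' w)) (u Fin.zero) ⟩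
    potential weight D'                ≤⟨ potential-reach weight weight-isPebblingWeight reach ⟩
    potential weight (witness c m)     ≡⟨ potential-witness c m ⟩
    c                                  ∎)
    where open ≤-Reasoning

  unsolvable-below : ∀ M → M < 2 ^ k + k → Σ Distribution λ D → mTotal k D ≡ M × ¬ Solvable (u Fin.zero) D
  unsolvable-below M M< with M <? 2 ^ k
  ... | yes M<2^k = witness M 0 , mTotal-witness M z≤n , witness-unsolvable M<2^k 0
  ... | no M≮2^k  = witness c (M ∸ c) , trans (mTotal-witness c singles≤k) (m∸n+n≡m c≤M) ,
                    witness-unsolvable c<2^k (M ∸ c)
    where
    c : ℕ
    c = 2 ^ k ∸ 1
    1+c≡2^k : suc c ≡ 2 ^ k
    1+c≡2^k = trans (+-comm 1 c) (m∸n+n≡m (m^n>0 2 k))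
    c<2^k : c < 2 ^ k
    c<2^k = ≤-reflexive 1+c≡2^k
    c≤M : c ≤ M
    c≤M = ≤-trans (n≤1+n c) (subst (_≤ M) (sym 1+c≡2^k) (≮⇒≥ M≮2^k))
    singles≤k : M ∸ c ≤ k
    singles≤k = ≤-trans (∸-monoˡ-≤ c (≤-pred (subst (λ x → M < x + k) (sym 1+c≡2^k) M<)))
                        (≤-reflexive (m+n∸m≡n c k))

  u₀-needs : ∀ M → AllSolvable (u Fin.zero) M → 2 ^ k + k ≤ M
  u₀-needs M all-solvable with 2 ^ k + k ≤? M
  ... | yes enough = enough
  ... | no too-few =
    let D , total≡M , unsolvable = unsolvable-below M (≰⇒> too-few)
    in ⊥-elim (unsolvable (all-solvable D total≡M))

  allSolvable : ∀ r → AllSolvable r (2 ^ k + k)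
  allSolvable (v i) = solvable-at-v i
  allSolvable (u j) = solvable-at-u j

  open Decision (MidPathMinusEnds k) _≟_ mTotal-isVertexSum adj? vertices ∈-vertices public
    using (rootedPebblingNumber)

-- The formula holds for every k = n ∸ 2.
corollary2p4 : ∀ (n : ℕ) → 2 ≤ n →
    Pebbling.IsPebblingNumber (MidPathMinusEnds (n ∸ 2)) (2 ^ (n ∸ 2) + (n ∸ 2))
corollary2p4 n _ =
  (λ r → rootedPebblingNumber r (allSolvable r)) ,
  u Fin.zero , allSolvable (u Fin.zero) , u₀-needs
  where open MiddleGraph (n ∸ 2)
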